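{- Let $C$ be a longest cycle in a graph $G$ and let $M$ be a path in $G-C$. Let $L_1,\dots,L_r$ be pairwise vertex-disjoint paths in $G-C$, where $L_i$ is a path with endvertices $v_i$ and $w_i$ (possibly $v_i=w_i$), such that $V(L_i)\cap V(M)=\{v_i\}$ for each $i=1,\dots,r$. Let $Z_i=N(w_i)\cap V(C)$ for $i=1,\dots,r$. Then $$|C|\ge\sum_{i=1}^r|Z_i|+\Big|\bigcup_{i=1}^rZ_i\Big|.$$
   Context: All graphs are finite, undirected, without loops or multiple edges. $N(x)$ denotes the set of neighbours of a vertex $x$. $G-C$ is the subgraph induced by $V(G)\setminus V(C)$. The length of a path is its number of edges. A single vertex and a single edge are regarded as cycles of lengths $1$ and $2$ respectively; otherwise the length $|C|$ of a cycle is its number of edges; a longest cycle is one of maximum length in this extended sense. -}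

module Defs where

open import Data.Nat using (ℕ; _≤_; _+_)
open import Data.Bool using (Bool; true; false; _∧_)
open import Data.Fin using (Fin; _≟_)
open import Data.Fin.Subset using (Subset; ⋃; ∣_∣)
open import Data.Maybe using (just)
open import Data.List using (List; []; _∷_; length; head; last; map; allFin)
open import Data.Nat.ListAction using (sum)
open import Data.List.Relation.Unary.Unique.Propositional using (Unique)
open import Data.List.Relation.Unary.Linked using (Linked)
open import Data.List.Membership.Propositional using (_∈_)
import Data.List.Membership.DecPropositional as DecMem
open import Data.Vec using (tabulate)
open import Data.Product using (_×_)
open import Relation.Nullary using (does; ¬_)
open import Relation.Binary.PropositionalEquality using (_≡_; _≢_)

record Graph (n : ℕ) : Set where
  field
    adj   : Fin n → Fin n → Bool
    sym   : ∀ x y → adj x y ≡ adj y x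
    irrefl : ∀ x → adj x x ≡ false

module _ {n : ℕ} (G : Graph n) where
  open Graph G
  open DecMem (_≟_ {n}) using (_∈?_)

  Edge : Fin n → Fin n → Set
  Edge x y = adj x y ≡ true

  -- A path: a nonempty list of distinct vertices, consecutive ones adjacent.
  -- Its length (number of edges) is length P ∸ 1; its vertex set is the list.
  IsPath : List (Fin n) → Set
  IsPath P = (P ≢ []) × Unique P × Linked Edge P

  IsPathBetween : List (Fin n) → Fin n → Fin n → Set
  IsPathBetween P v w = IsPath P × head P ≡ just v × last P ≡ just w

  -- Cycle in the extended sense: vertex list c₀ … c_{k-1}, distinct,
  -- consecutive adjacent, and if k ≥ 3 also c_{k-1} adjacent to c₀.
  -- k = 1: single vertex (length 1); k = 2: single edge (length 2).
  IsCycle : List (Fin n) → Set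
  IsCycle C = IsPath C × (3 ≤ length C → ∀ x y → head C ≡ just x → last C ≡ just y → Edge y x)

  -- In all cases the length |C| equals the number of vertices.
  cycleLength : List (Fin n) → ℕ
  cycleLength C = length C

  IsLongestCycle : List (Fin n) → Set
  IsLongestCycle C = IsCycle C × (∀ D → IsCycle D → cycleLength D ≤ cycleLength C)

  AvoidsCycle : List (Fin n) → List (Fin n) → Set
  AvoidsCycle C P = ∀ x → x ∈ P → ¬ (x ∈ C)

  nbrsOn : List (Fin n) → Fin n → Subset n
  nbrsOn C w = tabulate (λ x → adj w x ∧ does (x ∈? C))

sumFin : (r : ℕ) → (Fin r → ℕ) → ℕ
sumFin r f = sum (map f (allFin r))

unionFin : {n : ℕ} (r : ℕ) → (Fin r → Subset n) → Subset n
unionFin r Z = ⋃ (map Z (allFin r))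

-- Write hits x for the number of indices i with w i adjacent to x.  Counting
-- vertex by vertex along C, the left-hand side is Σ_{x ∈ C} (hits x + [hits x > 0])
-- (module Neighbourhoods).  For any i, j there is a route from w i to w j
-- outside C (back along L i, along M, out along L j) that is longer than the
-- distance of v i and v j on M (module Setting).  Choosing the extreme
-- indices adjacent to two cycle vertices a, b and joining them crosswise
-- (module Spread) gives a detour of C from a to b with length at least
-- (hits a + hits b)/2.  A detour cannot be longer than either arc of C it
-- bypasses, since otherwise C could be lengthened (module Cycles).  These
-- bounds on cyclically consecutive vertices with positive hits sum up to the
-- theorem (module CyclicWeight).
module Submission where

open import Data.Bool using (Bool; true; false; _∧_; _∨_; T?)
open import Data.Bool.Properties using (∧-identityʳ; ∧-zeroʳ; T-≡)
open import Data.Empty using (⊥-elim)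
open import Data.Fin using (Fin)
open import Data.Fin.Subset using (Subset; ⋃; ∣_∣)
open import Data.List
  using (List; []; _∷_; _++_; [_]; length; head; last; map; reverse; allFin; tabulate; filterᵇ; applyUpTo)
open import Data.List.Extrema.Nat using (argmin; argmax; f[argmin]≤f[xs]; f[xs]≤f[argmax]; argmin-all; argmax-all)
open import Data.List.Membership.Propositional using (_∈_)
import Data.List.Membership.DecPropositional as DecMembership
open import Data.List.Membership.Propositional.Properties
  using (∈-∃++; ∈-++⁺ˡ; ∈-++⁺ʳ; ∈-++⁻; ∈-allFin; ∈-filter⁺; ∈-filter⁻; ∈-map⁻; ∈-applyUpTo⁺)
open import Data.List.Membership.Setoid.Properties using (reverse⁻)
open import Data.List.Properties
  using (++-assoc; length-++; length-map; length-reverse; length-applyUpTo; map-++; map-tabulate;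
         reverse-++; unfold-reverse)
open import Data.List.Relation.Binary.Disjoint.Propositional using (Disjoint)
open import Data.List.Relation.Binary.Permutation.Propositional using (_↭_; ↭-sym; ↭⇒↭ₛ)
import Data.List.Relation.Binary.Permutation.Propositional.Properties as Permutation
import Data.List.Relation.Binary.Permutation.Setoid.Properties as PermutationSetoid
open import Data.List.Relation.Unary.All as All using (All; []; _∷_)
import Data.List.Relation.Unary.All.Properties as All
open import Data.List.Relation.Unary.AllPairs using ([]; _∷_)
open import Data.List.Relation.Unary.Any using (here; there)
open import Data.List.Relation.Unary.Linked as Linked using (Linked; []; [-]; _∷_; _∷′_)
open import Data.List.Relation.Unary.Unique.Propositional using (Unique)
import Data.List.Relation.Unary.Unique.Propositional.Properties as UniqueProps
open import Data.Maybe using (just)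
open import Data.Maybe.Relation.Binary.Connected using (Connected; just)
open import Data.Nat using (ℕ; zero; suc; _+_; _≤_; _<_; _∸_; s≤s; z≤n; _≤?_)
open import Data.Nat.ListAction using (sum)
open import Data.Nat.ListAction.Properties using (sum-++; sum-↭)
open import Data.Nat.Properties
open import Algebra.Properties.CommutativeSemigroup +-commutativeSemigroup using (interchange)
open import Data.Nat.Tactic.RingSolver using (solve-∀)
open import Data.Product using (_×_; _,_; proj₁; proj₂; ∃-syntax)
open import Data.Sum using (_⊎_; inj₁; inj₂)
import Data.Vec as Vec
open import Data.Vec.Properties using (lookup∘tabulate; lookup-zipWith; lookup-replicate)
open import Function using (_∘_)
open import Function.Bundles using (Equivalence)
open import Relation.Binary.Core using (Rel)
open import Relation.Binary.Definitions using (Symmetric; DecidableEquality; tri<; tri≈; tri>)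
open import Relation.Binary.PropositionalEquality
  using (_≡_; _≢_; refl; sym; trans; cong; cong₂; subst; setoid; module ≡-Reasoning)
open import Relation.Nullary using (¬_; yes; no)
open import Relation.Nullary.Decidable using (dec-true; dec-false)

open import Defs

open Vec using (lookup)

module ListFacts {a} {A : Set a} where

  head-++-∷ : ∀ (xs : List A) {x ys} → head (xs ++ x ∷ ys) ≡ head (xs ++ [ x ])
  head-++-∷ []      = refl
  head-++-∷ (_ ∷ _) = refl

  last-++-∷ : ∀ (xs : List A) {x ys} → last (xs ++ x ∷ ys) ≡ last (x ∷ ys)
  last-++-∷ []           = refl
  last-++-∷ (_ ∷ [])     = refl
  last-++-∷ (_ ∷ y ∷ xs) = last-++-∷ (y ∷ xs)

  module _ {r} {R : Rel A r} where

    glue : ∀ xs {x ys} → Linked R (xs ++ [ x ]) → Linked R (x ∷ ys) → Linked R (xs ++ x ∷ ys)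
    glue []       _  l₂ = l₂
    glue (y ∷ xs) l₁ l₂ =
      subst (Connected R (just y)) (sym (head-++-∷ xs)) (Linked.head′ l₁) ∷′ glue xs (Linked.tail l₁) l₂

    unglue : ∀ xs {x ys} → Linked R (xs ++ x ∷ ys) → Linked R (xs ++ [ x ]) × Linked R (x ∷ ys)
    unglue []       l = [-] , l
    unglue (y ∷ xs) l with unglue xs (Linked.tail l)
    ... | l₁ , l₂ = subst (Connected R (just y)) (head-++-∷ xs) (Linked.head′ l) ∷′ l₁ , l₂

    prefix : ∀ xs {ys} → Linked R (xs ++ ys) → Linked R xs
    prefix []           _ = []
    prefix (x ∷ [])     _ = [-]
    prefix (x ∷ y ∷ xs) l = Linked.head l ∷ prefix (y ∷ xs) (Linked.tail l)

    last-step : ∀ xs {y z} → Linked R (xs ++ [ z ]) → last xs ≡ just y → R y z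
    last-step (x ∷ [])     (e ∷ [-]) refl = e
    last-step (_ ∷ x ∷ xs) l         eq   = last-step (x ∷ xs) (Linked.tail l) eq

    extend : ∀ {xs y z} → Linked R xs → last xs ≡ just y → R y z → Linked R (xs ++ [ z ])
    extend []          ()
    extend [-]         refl e = e ∷ [-]
    extend (e′ ∷ l)    eq   e = e′ ∷ extend l eq e

    linked-reverse : Symmetric R → ∀ {xs} → Linked R xs → Linked R (reverse xs)
    linked-reverse R-sym []                     = []
    linked-reverse R-sym [-]                    = [-]
    linked-reverse R-sym {x ∷ y ∷ xs} (e ∷ l) =
      subst (Linked R) (sym shape) (glue (reverse xs) reversed (R-sym e ∷ [-]))
      where
      reversed : Linked R (reverse xs ++ [ y ])
      reversed = subst (Linked R) (unfold-reverse y xs) (linked-reverse R-sym l)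
      shape : reverse (x ∷ y ∷ xs) ≡ reverse xs ++ y ∷ [ x ]
      shape = begin
        reverse (x ∷ y ∷ xs)          ≡⟨ unfold-reverse x (y ∷ xs) ⟩
        reverse (y ∷ xs) ++ [ x ]     ≡⟨ cong (_++ [ x ]) (unfold-reverse y xs) ⟩
        (reverse xs ++ [ y ]) ++ [ x ] ≡⟨ ++-assoc (reverse xs) [ y ] [ x ] ⟩
        reverse xs ++ y ∷ [ x ]       ∎
        where open ≡-Reasoning

  reverse-between : ∀ (x : A) P y → reverse (x ∷ P ++ [ y ]) ≡ y ∷ reverse P ++ [ x ]
  reverse-between x P y = begin
    reverse (x ∷ P ++ [ y ])           ≡⟨ unfold-reverse x (P ++ [ y ]) ⟩
    reverse (P ++ [ y ]) ++ [ x ]      ≡⟨ cong (_++ [ x ]) (reverse-++ P [ y ]) ⟩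
    y ∷ reverse P ++ [ x ]             ∎
    where open ≡-Reasoning

  unique-reverse : ∀ {xs : List A} → Unique xs → Unique (reverse xs)
  unique-reverse {xs} = PermutationSetoid.Unique-resp-↭ (setoid A) (↭⇒↭ₛ (↭-sym (Permutation.↭-reverse xs)))

  ∈-reverse⁻ : ∀ {x : A} {xs} → x ∈ reverse xs → x ∈ xs
  ∈-reverse⁻ = reverse⁻ (setoid A)

  unique-++⁻ : ∀ (xs : List A) {ys} → Unique (xs ++ ys) → Unique xs × Unique ys × Disjoint xs ys
  unique-++⁻ []       u        = [] , u , λ ()
  unique-++⁻ (x ∷ xs) (x∉ ∷ u) with unique-++⁻ xs u
  ... | u₁ , u₂ , d = All.++⁻ˡ xs x∉ ∷ u₁ , u₂ , disjoint
    where
    disjoint : Disjoint (x ∷ xs) _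
    disjoint (here refl , q) = All.lookup (All.++⁻ʳ xs x∉) q refl
    disjoint (there p   , q) = d (p , q)

  unique-replace : ∀ X {K K′} Y → Unique (X ++ K ++ Y) → Unique K′ → Disjoint K′ (X ++ K ++ Y) →
    Unique (X ++ K′ ++ Y)
  unique-replace X {K} {K′} Y u uK′ fresh with unique-++⁻ X u
  ... | uX , uKY , dX with unique-++⁻ K uKY
  ... | _ , uY , _ = UniqueProps.++⁺ uX (UniqueProps.++⁺ uK′ uY (λ (p , q) → fresh (p , ∈-++⁺ʳ X (∈-++⁺ʳ K q)))) dXK′Y
    where
    dXK′Y : Disjoint X (K′ ++ Y)
    dXK′Y (p , q) with ∈-++⁻ K′ q
    ... | inj₁ q′ = fresh (q′ , ∈-++⁺ˡ p)
    ... | inj₂ q′ = dX (p , ∈-++⁺ʳ K q′)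

  last-∈ : ∀ {xs : List A} {y} → last xs ≡ just y → y ∈ xs
  last-∈ {x ∷ []}     refl = here refl
  last-∈ {_ ∷ x ∷ xs} eq   = there (last-∈ {x ∷ xs} eq)

  index : ∀ {x : A} {xs} → x ∈ xs → ℕ
  index (here _)  = 0
  index (there p) = suc (index p)

  index-injective : ∀ {x y : A} {xs} (p : x ∈ xs) (q : y ∈ xs) → index p ≡ index q → x ≡ y
  index-injective (here refl) (here refl) _  = refl
  index-injective (there p)   (there q)   eq = index-injective p q (suc-injective eq)

  split-at : ∀ {y : A} {xs} (q : y ∈ xs) → ∃[ B ] ∃[ Y ] xs ≡ B ++ y ∷ Y × index q ≡ length B
  split-at (here refl) = [] , _ , refl , refl
  split-at (there {x = z} q) with split-at q
  ... | B , Y , refl , eq = z ∷ B , Y , refl , cong suc eq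

  split-between : ∀ {x y : A} {xs} (p : x ∈ xs) (q : y ∈ xs) → index p < index q →
    ∃[ A′ ] ∃[ B ] ∃[ Y ] xs ≡ A′ ++ x ∷ B ++ y ∷ Y × index q ≡ index p + suc (length B)
  split-between (here refl) (there q) _ with split-at q
  ... | B , Y , refl , eq = [] , B , Y , refl , cong suc eq
  split-between (there {x = z} p) (there q) (s≤s lt) with split-between p q lt
  ... | A′ , B , Y , refl , eq = z ∷ A′ , B , Y , refl , cong suc eq

  unique-⊆-length : ∀ {xs ys : List A} → Unique xs → (∀ {z} → z ∈ xs → z ∈ ys) → length xs ≤ length ys
  unique-⊆-length {[]}     _        _ = z≤n
  unique-⊆-length {x ∷ xs} {ys} (x∉ ∷ u) xs⊆ys with ∈-∃++ (xs⊆ys (here refl))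
  ... | Y₁ , Y₂ , refl = subst (suc (length xs) ≤_) (sym (Permutation.↭-length moved))
                           (s≤s (unique-⊆-length u rest))
    where
    moved : Y₁ ++ [ x ] ++ Y₂ ↭ x ∷ Y₁ ++ Y₂
    moved = Permutation.shift x Y₁ Y₂
    rest : ∀ {z} → z ∈ xs → z ∈ Y₁ ++ Y₂
    rest {z} z∈xs with Permutation.∈-resp-↭ moved (xs⊆ys (there z∈xs))
    ... | here refl = ⊥-elim (All.lookup x∉ z∈xs refl)
    ... | there p   = p

bit : Bool → ℕ
bit true  = 1
bit false = 0

mark : ℕ → ℕ
mark zero    = 0
mark (suc _) = 1

module Sums where

  sum-map-+ : ∀ {A : Set} (f g : A → ℕ) xs → sum (map (λ x → f x + g x) xs) ≡ sum (map f xs) + sum (map g xs)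
  sum-map-+ f g []       = refl
  sum-map-+ f g (x ∷ xs) =
    trans (cong (f x + g x +_) (sum-map-+ f g xs)) (interchange (f x) (g x) (sum (map f xs)) (sum (map g xs)))

  sum-map-++ : ∀ {A : Set} (f : A → ℕ) xs ys → sum (map f (xs ++ ys)) ≡ sum (map f xs) + sum (map f ys)
  sum-map-++ f xs ys = trans (cong sum (map-++ f xs ys)) (sum-++ (map f xs) (map f ys))

  sum-map-cong : ∀ {A : Set} {f g : A → ℕ} xs → (∀ {x} → x ∈ xs → f x ≡ g x) → sum (map f xs) ≡ sum (map g xs)
  sum-map-cong []       _  = refl
  sum-map-cong (x ∷ xs) eq = cong₂ _+_ (eq (here refl)) (sum-map-cong xs (eq ∘ there))

  sum-map-zero : ∀ {A : Set} {f : A → ℕ} xs → (∀ {x} → x ∈ xs → f x ≡ 0) → sum (map f xs) ≡ 0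
  sum-map-zero []       _  = refl
  sum-map-zero (x ∷ xs) eq = cong₂ _+_ (eq (here refl)) (sum-map-zero xs (eq ∘ there))

  positive-count : ∀ {A : Set} (S : A → Bool) xs → 0 < sum (map (bit ∘ S) xs) → ∃[ x ] S x ≡ true
  positive-count S (x ∷ xs) pos with S x in eq
  ... | true  = x , eq
  ... | false = positive-count S xs pos

  sum-map-swap : ∀ {A B : Set} (F : A → B → ℕ) xs ys →
    sum (map (λ x → sum (map (F x) ys)) xs) ≡ sum (map (λ y → sum (map (λ x → F x y) xs)) ys)
  sum-map-swap F []       ys = sym (sum-map-zero ys (λ _ → refl))
  sum-map-swap F (x ∷ xs) ys =
    trans (cong (sum (map (F x) ys) +_) (sum-map-swap F xs ys))
          (sym (sum-map-+ (F x) (λ y → sum (map (λ x → F x y) xs)) ys))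

  module _ {A : Set} (_≟_ : DecidableEquality A) where
    open DecMembership _≟_ using (_∈?_)

    sum-support : ∀ (f : A → ℕ) U C → Unique U → Unique C → (∀ {x} → x ∈ C → x ∈ U) →
      (∀ {x} → x ∈ U → ¬ x ∈ C → f x ≡ 0) → sum (map f U) ≡ sum (map f C)
    sum-support f [] [] _ _ _ _ = refl
    sum-support f [] (c ∷ C) _ _ C⊆U _ with C⊆U (here refl)
    ... | ()
    sum-support f (u ∷ U) C (u∉U ∷ uU) uC C⊆U off with u ∈? C
    ... | no u∉C = cong₂ _+_ (off (here refl) u∉C) (sum-support f U C uU uC C⊆U′ (off ∘ there))
      where
      C⊆U′ : ∀ {x} → x ∈ C → x ∈ U
      C⊆U′ x∈C with C⊆U x∈C
      ... | here refl = ⊥-elim (u∉C x∈C)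
      ... | there p   = p
    ... | yes u∈C with ∈-∃++ u∈C
    ... | C₁ , C₂ , refl = trans (cong (f u +_) (sum-support f U (C₁ ++ C₂) uU uRest Rest⊆U off′))
                                 (sum-↭ (Permutation.map⁺ f (↭-sym moved)))
      where
      moved : C₁ ++ [ u ] ++ C₂ ↭ u ∷ C₁ ++ C₂
      moved = Permutation.shift u C₁ C₂
      uMoved : Unique (u ∷ C₁ ++ C₂)
      uMoved = PermutationSetoid.Unique-resp-↭ (setoid A) (↭⇒↭ₛ moved) uC
      uRest : Unique (C₁ ++ C₂)
      uRest with uMoved
      ... | _ ∷ u′ = u′
      Rest⊆U : ∀ {x} → x ∈ C₁ ++ C₂ → x ∈ U
      Rest⊆U {x} x∈ with uMoved | C⊆U (Permutation.∈-resp-↭ (↭-sym moved) (there x∈))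
      ... | u∉ ∷ _ | here refl = ⊥-elim (All.lookup u∉ x∈ refl)
      ... | _      | there p   = p
      off′ : ∀ {x} → x ∈ U → ¬ x ∈ C₁ ++ C₂ → f x ≡ 0
      off′ {x} x∈U x∉ = off (there x∈U) x∉C
        where
        x∉C : ¬ x ∈ C₁ ++ [ u ] ++ C₂
        x∉C x∈C with Permutation.∈-resp-↭ moved x∈C
        ... | here refl = All.lookup u∉U x∈U refl
        ... | there p   = x∉ p

module SubsetCounting where
  open Sums

  card-∷ : ∀ {n} b (p : Subset n) → ∣ b Vec.∷ p ∣ ≡ bit b + ∣ p ∣
  card-∷ true  p = refl
  card-∷ false p = refl

  card-sum : ∀ {n} (p : Subset n) → ∣ p ∣ ≡ sum (map (bit ∘ lookup p) (allFin n))
  card-sum Vec.[]            = refl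
  card-sum {suc n} (b Vec.∷ p) =
    trans (card-∷ b p) (cong (bit b +_) (trans (card-sum p) (cong sum reindex)))
    where
    reindex : map (bit ∘ lookup p) (allFin n) ≡ map (bit ∘ lookup (b Vec.∷ p)) (tabulate Data.Fin.suc)
    reindex = trans (map-tabulate (λ i → i) (bit ∘ lookup p))
                    (sym (map-tabulate Data.Fin.suc (bit ∘ lookup (b Vec.∷ p))))

  bit-∨ : ∀ b c s → bit c ≡ mark s → bit (b ∨ c) ≡ mark (bit b + s)
  bit-∨ true  c s _  = refl
  bit-∨ false c s eq = eq

  bit-⋃ : ∀ {n} {I : Set} (Z : I → Subset n) is x →
    bit (lookup (⋃ (map Z is)) x) ≡ mark (sum (map (λ i → bit (lookup (Z i) x)) is))
  bit-⋃ Z []       x = cong bit (lookup-replicate x false)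
  bit-⋃ Z (i ∷ is) x = trans (cong bit (lookup-zipWith _∨_ x (Z i) (⋃ (map Z is))))
                             (bit-∨ (lookup (Z i) x) _ _ (bit-⋃ Z is x))

module Neighbourhoods {n} (G : Graph n) (C : List (Fin n)) (uC : Unique C) where
  open Graph G using (adj)
  open DecMembership (Data.Fin._≟_ {n}) using (_∈?_)
  open Sums
  open SubsetCounting

  lookup-on : ∀ {w x} → x ∈ C → lookup (nbrsOn G C w) x ≡ adj w x
  lookup-on {w} {x} x∈C = trans (lookup∘tabulate _ x)
    (trans (cong (adj w x ∧_) (dec-true (x ∈? C) x∈C)) (∧-identityʳ (adj w x)))

  lookup-off : ∀ {w x} → ¬ x ∈ C → lookup (nbrsOn G C w) x ≡ false
  lookup-off {w} {x} x∉C = trans (lookup∘tabulate _ x)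
    (trans (cong (adj w x ∧_) (dec-false (x ∈? C) x∉C)) (∧-zeroʳ (adj w x)))

  sum-along-C : ∀ (f : Fin n → ℕ) → (∀ {x} → ¬ x ∈ C → f x ≡ 0) → sum (map f (allFin n)) ≡ sum (map f C)
  sum-along-C f off = sum-support Data.Fin._≟_ f (allFin n) C (UniqueProps.allFin⁺ n) uC (λ {x} _ → ∈-allFin x) (λ _ → off)

  card-nbrsOn : ∀ w → ∣ nbrsOn G C w ∣ ≡ sum (map (bit ∘ adj w) C)
  card-nbrsOn w = begin
    ∣ nbrsOn G C w ∣                                  ≡⟨ card-sum (nbrsOn G C w) ⟩
    sum (map (bit ∘ lookup (nbrsOn G C w)) (allFin n)) ≡⟨ sum-along-C _ (cong bit ∘ lookup-off) ⟩
    sum (map (bit ∘ lookup (nbrsOn G C w)) C)          ≡⟨ sum-map-cong C (cong bit ∘ lookup-on) ⟩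
    sum (map (bit ∘ adj w) C)                          ∎
    where open ≡-Reasoning

  module _ {r} (w : Fin r → Fin n) where

    hits : Fin n → ℕ
    hits x = sum (map (λ i → bit (adj (w i) x)) (allFin r))

    card-union : ∣ unionFin r (λ i → nbrsOn G C (w i)) ∣ ≡ sum (map (mark ∘ hits) C)
    card-union = begin
      ∣ unionFin r Z ∣                                      ≡⟨ card-sum (unionFin r Z) ⟩
      sum (map (bit ∘ lookup (unionFin r Z)) (allFin n))    ≡⟨ sum-map-cong (allFin n) (λ {x} _ → bit-⋃ Z (allFin r) x) ⟩
      sum (map (mark ∘ restricted) (allFin n))              ≡⟨ sum-along-C _ (λ x∉C → cong mark (sum-map-zero (allFin r) (λ _ → cong bit (lookup-off x∉C)))) ⟩
      sum (map (mark ∘ restricted) C)                       ≡⟨ sum-map-cong C (λ x∈C → cong mark (sum-map-cong (allFin r) (λ _ → cong bit (lookup-on x∈C)))) ⟩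
      sum (map (mark ∘ hits) C)                             ∎
      where
      open ≡-Reasoning
      Z : Fin r → Subset n
      Z i = nbrsOn G C (w i)
      restricted : Fin n → ℕ
      restricted x = sum (map (λ i → bit (lookup (Z i) x)) (allFin r))

    count-along-C : sumFin r (λ i → ∣ nbrsOn G C (w i) ∣) + ∣ unionFin r (λ i → nbrsOn G C (w i)) ∣
                    ≡ sum (map (λ x → hits x + mark (hits x)) C)
    count-along-C = begin
      sumFin r (λ i → ∣ nbrsOn G C (w i) ∣) + ∣ unionFin r (λ i → nbrsOn G C (w i)) ∣
        ≡⟨ cong₂ _+_ (sum-map-cong (allFin r) (λ {i} _ → card-nbrsOn (w i))) card-union ⟩
      sum (map (λ i → sum (map (bit ∘ adj (w i)) C)) (allFin r)) + sum (map (mark ∘ hits) C)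
        ≡⟨ cong (_+ sum (map (mark ∘ hits) C)) (sum-map-swap (λ i x → bit (adj (w i) x)) (allFin r) C) ⟩
      sum (map hits C) + sum (map (mark ∘ hits) C)
        ≡⟨ sym (sum-map-+ hits (mark ∘ hits) C) ⟩
      sum (map (λ x → hits x + mark (hits x)) C)
        ∎
      where open ≡-Reasoning

halve : ∀ {u v} → u + u ≤ v + v → u ≤ v
halve {u} {v} le with u ≤? v
... | yes u≤v = u≤v
... | no  u≰v = ⊥-elim (<⇒≱ (+-mono-< (≰⇒> u≰v) (≰⇒> u≰v)) le)

-- Summing the pair bound over cyclically consecutive positive entries gives
-- 2 Σ m ≤ 2 (|C| - #positive entries); the chain lemma performs this sum
-- along the entries between the first and last positive entry.
module CyclicWeight {X : Set} (m : X → ℕ) where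
  open Sums

  weight : X → ℕ
  weight x = m x + mark (m x)

  W : List X → ℕ
  W xs = sum (map weight xs)

  Null : List X → Set
  Null = All (λ x → m x ≡ 0)

  weight-null : ∀ {x} → m x ≡ 0 → weight x ≡ 0
  weight-null {x} eq rewrite eq = refl

  weight-pos : ∀ {x} → 0 < m x → weight x ≡ m x + 1
  weight-pos {x} pos with m x
  ... | suc _ = refl

  W-null : ∀ {Z} → Null Z → W Z ≡ 0
  W-null nZ = sum-map-zero _ (λ x∈Z → weight-null (All.lookup nZ x∈Z))

  W-null-++ : ∀ {Z} R → Null Z → W (Z ++ R) ≡ W R
  W-null-++ {Z} R nZ = trans (sum-map-++ weight Z R) (cong (_+ W R) (W-null nZ))

  zero-or-positive : ∀ x → m x ≡ 0 ⊎ 0 < m x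
  zero-or-positive x with m x
  ... | zero  = inj₁ refl
  ... | suc _ = inj₂ (s≤s z≤n)

  first-positive : ∀ xs → Null xs ⊎ ∃[ Z ] ∃[ a ] ∃[ R ] xs ≡ Z ++ a ∷ R × Null Z × 0 < m a
  first-positive [] = inj₁ []
  first-positive (x ∷ xs) with zero-or-positive x
  ... | inj₂ pos = inj₂ ([] , x , xs , refl , [] , pos)
  ... | inj₁ null with first-positive xs
  ...   | inj₁ nxs = inj₁ (null ∷ nxs)
  ...   | inj₂ (Z , a , R , refl , nZ , pos) = inj₂ (x ∷ Z , a , R , refl , null ∷ nZ , pos)

  last-positive : ∀ xs → Null xs ⊎ ∃[ B ] ∃[ y ] ∃[ Ys ] xs ≡ B ++ y ∷ Ys × 0 < m y × Null Ys
  last-positive [] = inj₁ []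
  last-positive (x ∷ xs) with last-positive xs
  ... | inj₂ (B , y , Ys , refl , pos , nYs) = inj₂ (x ∷ B , y , Ys , refl , pos , nYs)
  ... | inj₁ nxs with zero-or-positive x
  ...   | inj₁ null = inj₁ (null ∷ nxs)
  ...   | inj₂ pos  = inj₂ ([] , x , xs , refl , pos , nxs)

  PairBound : List X → Set
  PairBound C = ∀ A a B b Ys → C ≡ A ++ a ∷ B ++ b ∷ Ys → 0 < m a → 0 < m b →
    m a + m b ≤ length B + length B × m a + m b ≤ (length A + length Ys) + (length A + length Ys)

  SingleBound : List X → Set
  SingleBound C = ∀ A a Ys → C ≡ A ++ a ∷ Ys → 0 < m a → m a < length C

  chain : ∀ {C} → PairBound C → ∀ Pre a Z B y Post → C ≡ Pre ++ a ∷ Z ++ B ++ y ∷ Post →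
    Null Z → 0 < m a → 0 < m y → W B + W B + m a + m y ≤ (length Z + length B) + (length Z + length B)
  chain pair Pre a Z [] y Post split nZ pa py = begin
    m a + m y                        ≤⟨ proj₁ (pair Pre a Z y Post split pa py) ⟩
    length Z + length Z              ≡⟨ cong (λ k → k + k) (sym (+-identityʳ (length Z))) ⟩
    (length Z + 0) + (length Z + 0)  ∎
    where open ≤-Reasoning
  chain {C} pair Pre a Z (x ∷ B) y Post split nZ pa py with zero-or-positive x
  ... | inj₁ null = begin
    W (x ∷ B) + W (x ∷ B) + m a + m y
      ≡⟨ cong (λ k → (k + W B) + (k + W B) + m a + m y) (weight-null null) ⟩
    W B + W B + m a + m y
      ≤⟨ chain pair Pre a (Z ++ [ x ]) B y Post split′ (All.++⁺ nZ (null ∷ [])) pa py ⟩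
    (length (Z ++ [ x ]) + length B) + (length (Z ++ [ x ]) + length B)
      ≡⟨ cong (λ k → k + k) longer ⟩
    (length Z + suc (length B)) + (length Z + suc (length B))
      ∎
    where
    open ≤-Reasoning
    split′ : C ≡ Pre ++ a ∷ (Z ++ [ x ]) ++ B ++ y ∷ Post
    split′ = trans split (cong (λ t → Pre ++ a ∷ t) (sym (++-assoc Z [ x ] (B ++ y ∷ Post))))
    longer : length (Z ++ [ x ]) + length B ≡ length Z + suc (length B)
    longer = trans (cong (_+ length B) (length-++ Z)) (+-assoc (length Z) 1 (length B))
  ... | inj₂ px = begin
    W (x ∷ B) + W (x ∷ B) + m a + m y
      ≡⟨ cong (λ k → (k + W B) + (k + W B) + m a + m y) (weight-pos px) ⟩
    ((m x + 1) + W B) + ((m x + 1) + W B) + m a + m y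
      ≡⟨ regroup (m a) (m x) (m y) (W B) ⟩
    (m a + m x) + (W B + W B + m x + m y) + 2
      ≤⟨ +-monoˡ-≤ 2 (+-mono-≤ gap rest) ⟩
    (length Z + length Z) + (length B + length B) + 2
      ≡⟨ spread-out (length Z) (length B) ⟩
    (length Z + suc (length B)) + (length Z + suc (length B))
      ∎
    where
    open ≤-Reasoning
    gap : m a + m x ≤ length Z + length Z
    gap = proj₁ (pair Pre a Z x (B ++ y ∷ Post) split pa px)
    rest : W B + W B + m x + m y ≤ length B + length B
    rest = chain pair (Pre ++ a ∷ Z) x [] B y Post (trans split (sym (++-assoc Pre (a ∷ Z) _))) [] px py
    regroup : ∀ a x y w → ((x + 1) + w) + ((x + 1) + w) + a + y ≡ (a + x) + (w + w + x + y) + 2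
    regroup = solve-∀
    spread-out : ∀ z b → (z + z) + (b + b) + 2 ≡ (z + suc b) + (z + suc b)
    spread-out = solve-∀

  cyclic-weight : ∀ {C} → PairBound C → SingleBound C → W C ≤ length C
  cyclic-weight {C} pair single with first-positive C
  ... | inj₁ nC = subst (_≤ length C) (sym (W-null nC)) z≤n
  ... | inj₂ (Z , a , R , refl , nZ , pa) with last-positive R
  ...   | inj₁ nR = begin
    W (Z ++ a ∷ R)   ≡⟨ W-null-++ (a ∷ R) nZ ⟩
    weight a + W R   ≡⟨ cong₂ _+_ (weight-pos pa) (W-null nR) ⟩
    m a + 1 + 0      ≡⟨ trans (+-identityʳ _) (+-comm (m a) 1) ⟩
    suc (m a)        ≤⟨ single Z a R refl pa ⟩
    length (Z ++ a ∷ R) ∎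
    where open ≤-Reasoning
  ...   | inj₂ (B , y , Ys , refl , py , nYs) = halve (begin
    W C + W C                                ≡⟨ cong (λ k → k + k) segment ⟩
    (m a + 1 + (W B + (m y + 1))) + (m a + 1 + (W B + (m y + 1)))
                                             ≡⟨ regroup (m a) (m y) (W B) ⟩
    (W B + W B + m a + m y) + (m a + m y) + 4 ≤⟨ +-monoˡ-≤ 4 (+-mono-≤ inner outer) ⟩
    (b + b) + (s + s) + 4                    ≡⟨ collect b s ⟩
    (s + (b + 2)) + (s + (b + 2))            ≡⟨ cong (λ k → k + k) (sym size) ⟩
    length C + length C                      ∎)
    where
    open ≤-Reasoning
    regroup : ∀ a y w → (a + 1 + (w + (y + 1))) + (a + 1 + (w + (y + 1))) ≡ (w + w + a + y) + (a + y) + 4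
    regroup = solve-∀
    collect : ∀ b s → (b + b) + (s + s) + 4 ≡ (s + (b + 2)) + (s + (b + 2))
    collect = solve-∀
    reorder : ∀ p q t → p + suc (q + suc t) ≡ (p + t) + (q + 2)
    reorder = solve-∀
    b = length B
    s = length Z + length Ys
    inner : W B + W B + m a + m y ≤ b + b
    inner = chain pair Z a [] B y Ys refl [] pa py
    outer : m a + m y ≤ s + s
    outer = proj₂ (pair Z a B y Ys refl pa py)
    segment : W C ≡ m a + 1 + (W B + (m y + 1))
    segment = begin-equality
      W C                                        ≡⟨ W-null-++ (a ∷ B ++ y ∷ Ys) nZ ⟩
      weight a + W (B ++ y ∷ Ys)                 ≡⟨ cong (weight a +_) (sum-map-++ weight B (y ∷ Ys)) ⟩
      weight a + (W B + (weight y + W Ys))       ≡⟨ cong₂ (λ u v → u + (W B + v)) (weight-pos pa)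
                                                      (cong₂ _+_ (weight-pos py) (W-null nYs)) ⟩
      m a + 1 + (W B + (m y + 1 + 0))            ≡⟨ cong (λ k → m a + 1 + (W B + k)) (+-identityʳ _) ⟩
      m a + 1 + (W B + (m y + 1))                ∎
    size : length C ≡ s + (b + 2)
    size = begin-equality
      length C                                   ≡⟨ length-++ Z ⟩
      length Z + suc (length (B ++ y ∷ Ys))      ≡⟨ cong (λ k → length Z + suc k) (length-++ B) ⟩
      length Z + suc (b + suc (length Ys))       ≡⟨ reorder (length Z) b (length Ys) ⟩
      s + (b + 2)                                ∎

module Cycles {n} (G : Graph n) where
  open ListFacts

  E : Fin n → Fin n → Set
  E = Edge G

  edge-sym : ∀ {x y} → E x y → E y x
  edge-sym {x} {y} e = trans (Graph.sym G y x) e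

  closing-edge : ∀ {C x y} → IsCycle G C → 2 ≤ length C → head C ≡ just x → last C ≡ just y → E y x
  closing-edge {_ ∷ []}        _                       (s≤s ()) _ _
  closing-edge {_ ∷ _ ∷ []}    ((_ , _ , e ∷ [-]) , _) _ refl refl = edge-sym e
  closing-edge {_ ∷ _ ∷ _ ∷ _} (_ , close)             _ hx   ly   = close (s≤s (s≤s (s≤s z≤n))) _ _ hx ly

  same-ends-cycle : ∀ {C D} → IsCycle G C → 2 ≤ length C → IsPath G D →
    head D ≡ head C → last D ≡ last C → IsCycle G D
  same-ends-cycle cyc two path hD lD = path , λ _ x y hx ly → closing-edge cyc two (trans (sym hD) hx) (trans (sym lD) ly)

  closed-walk-cycle : ∀ x Q → Unique (x ∷ Q) → Linked E (x ∷ Q ++ [ x ]) → IsCycle G (x ∷ Q)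
  closed-walk-cycle x Q u l = ((λ ()) , u , prefix (x ∷ Q) l) , λ { _ _ _ refl ly → last-step (x ∷ Q) l ly }

  Detour : List (Fin n) → Fin n → List (Fin n) → Fin n → Set
  Detour C a P b = Unique P × AvoidsCycle G C P × Linked E (a ∷ P ++ [ b ])

  detour-reverse : ∀ {C a P b} → Detour C a P b → Detour C b (reverse P) a
  detour-reverse {C} {a} {P} {b} (u , avoids , l) =
    unique-reverse u , (λ x x∈ → avoids x (∈-reverse⁻ x∈)) ,
    subst (Linked E) (reverse-between a P b) (linked-reverse edge-sym l)

  length-between : ∀ A (a : Fin n) X b Ys → length (A ++ a ∷ X ++ b ∷ Ys) ≡ length X + (2 + (length A + length Ys))
  length-between A a X b Ys = begin
    length (A ++ a ∷ X ++ b ∷ Ys)              ≡⟨ length-++ A ⟩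
    length A + suc (length (X ++ b ∷ Ys))      ≡⟨ cong (λ k → length A + suc k) (length-++ X) ⟩
    length A + suc (length X + suc (length Ys)) ≡⟨ reorder (length A) (length X) (length Ys) ⟩
    length X + (2 + (length A + length Ys))    ∎
    where
    open ≡-Reasoning
    reorder : ∀ p q t → p + suc (q + suc t) ≡ q + (2 + (p + t))
    reorder = solve-∀

  module _ {C : List (Fin n)} (longest : IsLongestCycle G C) where

    private
      cyc : IsCycle G C
      cyc = proj₁ longest
      uC : Unique C
      uC = proj₁ (proj₂ (proj₁ cyc))
      lC : Linked E C
      lC = proj₂ (proj₂ (proj₁ cyc))

    -- A detour from a back to a closes up to the cycle a ∷ P.
    detour-loop : ∀ {a P} → a ∈ C → Detour C a P a → suc (length P) ≤ length C
    detour-loop {a} {P} a∈C (u , avoids , l) =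
      proj₂ longest (a ∷ P) (closed-walk-cycle a P (All.tabulate a∉P ∷ u) l)
      where
      a∉P : ∀ {x} → x ∈ P → a ≢ x
      a∉P x∈P refl = avoids _ x∈P a∈C

    module _ {A a B b Ys P} (split : C ≡ A ++ a ∷ B ++ b ∷ Ys) (detour : Detour C a P b) where

      private
        uP = proj₁ detour
        avoids = proj₁ (proj₂ detour)
        lP = proj₂ (proj₂ detour)
        linked-C : Linked E (A ++ a ∷ B ++ b ∷ Ys)
        linked-C = subst (Linked E) split lC
        up-to-a : Linked E (A ++ [ a ])
        up-to-a = proj₁ (unglue A linked-C)
        arc : Linked E (a ∷ B ++ [ b ])
        arc = proj₁ (unglue (a ∷ B) (proj₂ (unglue A linked-C)))
        from-b : Linked E (b ∷ Ys)
        from-b = proj₂ (unglue (a ∷ B) (proj₂ (unglue A linked-C)))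
        split-after-a : C ≡ (A ++ [ a ]) ++ B ++ b ∷ Ys
        split-after-a = trans split (sym (++-assoc A [ a ] (B ++ b ∷ Ys)))
        split-arc : C ≡ A ++ (a ∷ B ++ [ b ]) ++ Ys
        split-arc = trans split (cong (λ t → A ++ a ∷ t) (sym (++-assoc B [ b ] Ys)))

      -- Replacing the arc a ∷ B ++ [ b ] by a ∷ P ++ [ b ] gives a cycle.
      detour-across : length P ≤ length B
      detour-across = +-cancelʳ-≤ _ (length P) (length B) (begin
        length P + _   ≡⟨ sym (length-between A a P b Ys) ⟩
        length D       ≤⟨ proj₂ longest D (same-ends-cycle cyc two pathD heads lasts) ⟩
        length C       ≡⟨ cong length split ⟩
        length (A ++ a ∷ B ++ b ∷ Ys) ≡⟨ length-between A a B b Ys ⟩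
        length B + _   ∎)
        where
        open ≤-Reasoning
        D = A ++ a ∷ P ++ b ∷ Ys
        two : 2 ≤ length C
        two = subst (2 ≤_) (sym (trans (cong length split) (length-between A a B b Ys)))
                (≤-trans (m≤m+n 2 _) (m≤n+m _ (length B)))
        pathD : IsPath G D
        pathD = nonempty A , uD , glue A up-to-a (glue (a ∷ P) lP from-b)
          where
          nonempty : ∀ X → X ++ a ∷ P ++ b ∷ Ys ≢ []
          nonempty []      ()
          nonempty (_ ∷ _) ()
          uD : Unique D
          uD = subst Unique (++-assoc A [ a ] (P ++ b ∷ Ys))
            (unique-replace (A ++ [ a ]) (b ∷ Ys) (subst Unique split-after-a uC) uP
              (λ (p , q) → avoids _ p (subst (_ ∈_) (sym split-after-a) q)))
        heads : head D ≡ head C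
        heads = trans (head-++-∷ A) (trans (sym (head-++-∷ A)) (cong head (sym split)))
        lasts : last D ≡ last C
        lasts = trans (last-++-∷ A) (trans (last-++-∷ (a ∷ P))
                  (trans (sym (trans (last-++-∷ A) (last-++-∷ (a ∷ B)))) (cong last (sym split))))

      -- The arc a ∷ B ++ [ b ] closed up by the reversed detour is a cycle.
      detour-around : length P ≤ length A + length Ys
      detour-around = +-cancelˡ-≤ (length K) (length P) _ (begin
        length K + length P                     ≡⟨ sym (trans (length-++ K) (cong (length K +_) (length-reverse P))) ⟩
        length D                                ≤⟨ proj₂ longest D (closed-walk-cycle a Q uD closed) ⟩
        length C                                ≡⟨ cong length split ⟩
        length (A ++ a ∷ B ++ b ∷ Ys)           ≡⟨ length-between A a B b Ys ⟩
        length B + (2 + (length A + length Ys)) ≡⟨ arc-length ⟩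
        length K + (length A + length Ys)       ∎)
        where
        open ≤-Reasoning
        Q = (B ++ [ b ]) ++ reverse P
        D = a ∷ Q
        K = a ∷ B ++ [ b ]
        arc-length : length B + (2 + (length A + length Ys)) ≡ length K + (length A + length Ys)
        arc-length = trans (sym (+-assoc (length B) 2 _)) (cong (_+ (length A + length Ys))
          (trans (+-comm (length B) 2) (cong suc (sym (trans (length-++ B) (+-comm (length B) 1))))))
        uK : Unique K
        uK = proj₁ (unique-++⁻ K (proj₁ (proj₂ (unique-++⁻ A (subst Unique split-arc uC)))))
        uD : Unique D
        uD = UniqueProps.++⁺ uK (unique-reverse uP) (λ (p , q) → avoids _ (∈-reverse⁻ q)
               (subst (_ ∈_) (sym split-arc) (∈-++⁺ʳ A (∈-++⁺ˡ p))))
        closed : Linked E (a ∷ Q ++ [ a ])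
        closed = subst (Linked E) (cong (a ∷_) (sym shape))
                   (glue (a ∷ B) arc (proj₂ (proj₂ (detour-reverse detour))))
          where
          shape : Q ++ [ a ] ≡ B ++ b ∷ reverse P ++ [ a ]
          shape = trans (++-assoc (B ++ [ b ]) (reverse P) [ a ]) (++-assoc B [ b ] _)

-- A set S of indices whose positions lie
-- in a window [lo, hi] has at most hi + 1 - lo members; hence, if every pair of
-- indices i j is joined by something of length ℓ i j exceeding the distance of
-- their positions, two nonempty sets S and T contain i ∈ S and j ∈ T with
-- |S| + |T| ≤ 2 ℓ i j (join the extreme members crosswise and take the longer).
module Spread {r : ℕ} (pos : Fin r → ℕ) (pos-injective : ∀ {i j} → pos i ≡ pos j → i ≡ j) where
  open Sums

  count : (Fin r → Bool) → ℕ
  count S = sum (map (bit ∘ S) (allFin r))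

  members : (Fin r → Bool) → List (Fin r)
  members S = filterᵇ S (allFin r)

  count-filter : ∀ (S : Fin r → Bool) xs → sum (map (bit ∘ S) xs) ≡ length (filterᵇ S xs)
  count-filter S []       = refl
  count-filter S (x ∷ xs) with S x
  ... | true  = cong suc (count-filter S xs)
  ... | false = count-filter S xs

  member⁺ : ∀ {S k} → S k ≡ true → k ∈ members S
  member⁺ {S} {k} sk = ∈-filter⁺ (T? ∘ S) (∈-allFin k) (Equivalence.from T-≡ sk)

  member⁻ : ∀ {S k} → k ∈ members S → S k ≡ true
  member⁻ {S} k∈ = Equivalence.to T-≡ (proj₂ (∈-filter⁻ (T? ∘ S) {xs = allFin r} k∈))

  window : ∀ S lo hi → (∀ k → S k ≡ true → lo ≤ pos k × pos k ≤ hi) → count S ≤ suc hi ∸ lo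
  window S lo hi bounds = begin
    count S                                   ≡⟨ count-filter S (allFin r) ⟩
    length (members S)                        ≡⟨ sym (length-map pos (members S)) ⟩
    length (map pos (members S))              ≤⟨ unique-⊆-length distinct inside ⟩
    length (applyUpTo (lo +_) (suc hi ∸ lo))  ≡⟨ length-applyUpTo (lo +_) (suc hi ∸ lo) ⟩
    suc hi ∸ lo                               ∎
    where
    open ≤-Reasoning
    open ListFacts
    distinct : Unique (map pos (members S))
    distinct = UniqueProps.map⁺ pos-injective (UniqueProps.filter⁺ (T? ∘ S) (UniqueProps.allFin⁺ r))
    inside : ∀ {z} → z ∈ map pos (members S) → z ∈ applyUpTo (lo +_) (suc hi ∸ lo)
    inside z∈ with ∈-map⁻ pos z∈
    ... | k , k∈ , refl with bounds k (member⁻ k∈)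
    ...   | lo≤ , ≤hi = subst (_∈ _) (m+[n∸m]≡n lo≤) (∈-applyUpTo⁺ (lo +_) (∸-monoˡ-< (s≤s ≤hi) lo≤))

  extremes : ∀ S {s} → S s ≡ true → ∃[ lo ] ∃[ hi ]
    (∀ k → S k ≡ true → pos lo ≤ pos k × pos k ≤ pos hi) × S lo ≡ true × S hi ≡ true
  extremes S {s} ss = lo , hi , (λ k sk → All.lookup (f[argmin]≤f[xs] s (members S)) (member⁺ sk)
                                        , All.lookup (f[xs]≤f[argmax] s (members S)) (member⁺ sk))
                    , argmin-all pos ss inS , argmax-all pos ss inS
    where
    lo = argmin pos s (members S)
    hi = argmax pos s (members S)
    inS : All (λ k → S k ≡ true) (members S)
    inS = All.tabulate member⁻

  span : ∀ S lo hi → (∀ k → S k ≡ true → pos lo ≤ pos k × pos k ≤ pos hi) → S lo ≡ true →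
    count S + pos lo ≤ suc (pos hi)
  span S lo hi bounds slo = begin
    count S + pos lo                   ≤⟨ +-monoˡ-≤ (pos lo) (window S (pos lo) (pos hi) bounds) ⟩
    (suc (pos hi) ∸ pos lo) + pos lo   ≡⟨ m∸n+n≡m (m≤n⇒m≤1+n (proj₂ (bounds lo slo))) ⟩
    suc (pos hi)                       ∎
    where open ≤-Reasoning

  spread : ∀ (ℓ : Fin r → Fin r → ℕ) → (∀ i j → pos j < pos i + ℓ i j × pos i < pos j + ℓ i j) →
    ∀ S T {s t} → S s ≡ true → T t ≡ true →
    ∃[ i ] ∃[ j ] S i ≡ true × T j ≡ true × count S + count T ≤ ℓ i j + ℓ i j
  spread ℓ far S T ss tt with extremes S ss | extremes T tt
  ... | loS , hiS , boundsS , sloS , shiS | loT , hiT , boundsT , tloT , thiT = choose (≤-total ℓ₁ ℓ₂)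
    where
    spanS = span S loS hiS boundsS sloS
    spanT = span T loT hiT boundsT tloT
    ℓ₁ = ℓ loS hiT
    ℓ₂ = ℓ hiS loT
    crosswise : count S + count T ≤ ℓ₁ + ℓ₂
    crosswise = +-cancelʳ-≤ (pos loS + pos loT) _ _ (begin
      (count S + count T) + (pos loS + pos loT)  ≡⟨ interchange (count S) (count T) (pos loS) (pos loT) ⟩
      (count S + pos loS) + (count T + pos loT)  ≤⟨ +-mono-≤ (≤-trans spanS (proj₂ (far hiS loT)))
                                                              (≤-trans spanT (proj₁ (far loS hiT))) ⟩
      (pos loT + ℓ₂) + (pos loS + ℓ₁)            ≡⟨ regroup (pos loS) (pos loT) ℓ₁ ℓ₂ ⟩
      (ℓ₁ + ℓ₂) + (pos loS + pos loT)            ∎)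
      where
      open ≤-Reasoning
      regroup : ∀ u v p q → (v + q) + (u + p) ≡ (p + q) + (u + v)
      regroup = solve-∀
    choose : ℓ₁ ≤ ℓ₂ ⊎ ℓ₂ ≤ ℓ₁ → ∃[ i ] ∃[ j ] S i ≡ true × T j ≡ true × count S + count T ≤ ℓ i j + ℓ i j
    choose (inj₁ ℓ₁≤ℓ₂) = hiS , loT , shiS , tloT , ≤-trans crosswise (+-monoˡ-≤ ℓ₂ ℓ₁≤ℓ₂)
    choose (inj₂ ℓ₂≤ℓ₁) = loS , hiT , sloS , thiT , ≤-trans crosswise (+-monoʳ-≤ ℓ₁ ℓ₂≤ℓ₁)

module Setting {n} (G : Graph n) (C : List (Fin n)) (longest : IsLongestCycle G C)
  (M : List (Fin n)) (pathM : IsPath G M) (avoidsM : AvoidsCycle G C M)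
  (r : ℕ) (L : Fin r → List (Fin n)) (v w : Fin r → Fin n)
  (pathL : ∀ i → IsPathBetween G (L i) (v i) (w i))
  (avoidsL : ∀ i → AvoidsCycle G C (L i))
  (disjoint : ∀ i j → i ≢ j → ∀ x → x ∈ L i → ¬ (x ∈ L j))
  (v∈M : ∀ i → v i ∈ M)
  (meet : ∀ i x → x ∈ L i → x ∈ M → x ≡ v i) where

  open Graph G using (adj)
  open ListFacts
  open Cycles G

  pos : Fin r → ℕ
  pos i = index (v∈M i)

  leg : Fin r → List (Fin n)
  leg i with L i | proj₁ (proj₂ (pathL i))
  ... | _ ∷ Q | _ = Q

  L≡ : ∀ i → L i ≡ v i ∷ leg i
  L≡ i with L i | proj₁ (proj₂ (pathL i))
  ... | _ ∷ Q | refl = refl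

  on-L : ∀ i {x} → x ∈ v i ∷ leg i → x ∈ L i
  on-L i = subst (_ ∈_) (sym (L≡ i))

  unique-L : ∀ i → Unique (v i ∷ leg i)
  unique-L i = subst Unique (L≡ i) (proj₁ (proj₂ (proj₁ (pathL i))))

  leg-linked : ∀ i {a} → E (w i) a → Linked E (v i ∷ leg i ++ [ a ])
  leg-linked i {a} e = subst (λ P → Linked E (P ++ [ a ])) (L≡ i)
    (extend (proj₂ (proj₂ (proj₁ (pathL i)))) (proj₂ (proj₂ (pathL i))) e)

  pos-injective : ∀ {i j} → pos i ≡ pos j → i ≡ j
  pos-injective {i} {j} eq with i Data.Fin.≟ j
  ... | yes i≡j = i≡j
  ... | no  i≢j = ⊥-elim (disjoint i j i≢j (v i) (on-L i (here refl))
                   (subst (_∈ L j) (sym (index-injective (v∈M i) (v∈M j) eq)) (on-L j (here refl))))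

  record Route (i j : Fin r) : Set where
    field
      inner    : List (Fin n)
      unique   : Unique inner
      avoids   : AvoidsCycle G C inner
      joins    : ∀ {a b} → E a (w i) → E (w j) b → Linked E (a ∷ inner ++ [ b ])
      covers-j : pos j < pos i + length inner
      covers-i : pos i < pos j + length inner

  route-self : ∀ i → Route i i
  route-self i = record
    { inner    = [ w i ]
    ; unique   = [] ∷ []
    ; avoids   = λ { _ (here refl) → avoidsL i (w i) (last-∈ (proj₂ (proj₂ (pathL i)))) }
    ; joins    = λ ea eb → ea ∷ eb ∷ [-]
    ; covers-j = m<m+n (pos i) (s≤s z≤n)
    ; covers-i = m<m+n (pos i) (s≤s z≤n)
    }

  route-reverse : ∀ {i j} → Route i j → Route j i
  route-reverse {i} {j} ρ = record
    { inner    = reverse inner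
    ; unique   = unique-reverse unique
    ; avoids   = λ x x∈ → avoids x (∈-reverse⁻ x∈)
    ; joins    = λ {a} {b} ea eb → subst (Linked E) (reverse-between b inner a)
                   (linked-reverse edge-sym (joins (edge-sym eb) (edge-sym ea)))
    ; covers-j = subst (λ k → pos i < pos j + k) (sym (length-reverse inner)) covers-i
    ; covers-i = subst (λ k → pos j < pos i + k) (sym (length-reverse inner)) covers-j
    }
    where open Route ρ

  route-forward : ∀ i j → pos i < pos j → Route i j
  route-forward i j lt with split-between (v∈M i) (v∈M j) lt
  ... | A′ , B , Y , splitM , gap = record
    { inner    = inner
    ; unique   = unique-inner
    ; avoids   = avoids
    ; joins    = joins
    ; covers-j = subst (_< pos i + length inner) (sym gap) (+-monoʳ-< (pos i) long)
    ; covers-i = <-≤-trans lt (m≤m+n (pos j) (length inner))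
    }
    where
    inner : List (Fin n)
    inner = reverse (leg i) ++ (v i ∷ B) ++ (v j ∷ leg j)
    i≢j : i ≢ j
    i≢j refl = <-irrefl refl lt
    segment : Unique (v i ∷ B) × Unique (v j ∷ Y) × Disjoint (v i ∷ B) (v j ∷ Y)
    segment = unique-++⁻ (v i ∷ B) (proj₁ (proj₂ (unique-++⁻ A′ (subst Unique splitM (proj₁ (proj₂ pathM))))))
    on-M : ∀ {x} → x ∈ v i ∷ B → x ∈ M
    on-M x∈ = subst (_ ∈_) (sym splitM) (∈-++⁺ʳ A′ (∈-++⁺ˡ x∈))
    leg-unique : Unique (leg i)
    leg-unique with unique-L i
    ... | _ ∷ u = u
    not-v-i : ∀ {x} → x ∈ leg i → x ≢ v i
    not-v-i x∈ refl with unique-L i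
    ... | v∉ ∷ _ = All.lookup v∉ x∈ refl
    disjoint-M-Lj : Disjoint (v i ∷ B) (v j ∷ leg j)
    disjoint-M-Lj (p , q) = proj₂ (proj₂ segment)
      (subst (_∈ v i ∷ B) (meet j _ (on-L j q) (on-M p)) p , here refl)
    disjoint-Li : Disjoint (reverse (leg i)) ((v i ∷ B) ++ (v j ∷ leg j))
    disjoint-Li (p , q) with ∈-reverse⁻ p | ∈-++⁻ (v i ∷ B) q
    ... | p′ | inj₁ q′ = not-v-i p′ (meet i _ (on-L i (there p′)) (on-M q′))
    ... | p′ | inj₂ q′ = disjoint i j i≢j _ (on-L i (there p′)) (on-L j q′)
    unique-inner : Unique inner
    unique-inner = UniqueProps.++⁺ (unique-reverse leg-unique)
                     (UniqueProps.++⁺ (proj₁ segment) (unique-L j) disjoint-M-Lj) disjoint-Li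
    avoids : AvoidsCycle G C inner
    avoids x x∈ with ∈-++⁻ (reverse (leg i)) x∈
    ... | inj₁ p = avoidsL i x (on-L i (there (∈-reverse⁻ p)))
    ... | inj₂ q with ∈-++⁻ (v i ∷ B) q
    ...   | inj₁ q′ = avoidsM x (on-M q′)
    ...   | inj₂ q′ = avoidsL j x (on-L j q′)
    joins : ∀ {a b} → E a (w i) → E (w j) b → Linked E (a ∷ inner ++ [ b ])
    joins {a} {b} ea eb = subst (Linked E) (cong (a ∷_) (sym shape)) (glue (a ∷ reverse (leg i)) back (glue (v i ∷ B) along out))
      where
      back : Linked E (a ∷ reverse (leg i) ++ [ v i ])
      back = subst (Linked E) (reverse-between (v i) (leg i) a) (linked-reverse edge-sym (leg-linked i (edge-sym ea)))
      along : Linked E (v i ∷ B ++ [ v j ])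
      along = proj₁ (unglue (v i ∷ B) (proj₂ (unglue A′ (subst (Linked E) splitM (proj₂ (proj₂ pathM))))))
      out : Linked E (v j ∷ leg j ++ [ b ])
      out = leg-linked j eb
      shape : inner ++ [ b ] ≡ reverse (leg i) ++ v i ∷ B ++ v j ∷ leg j ++ [ b ]
      shape = trans (++-assoc (reverse (leg i)) (v i ∷ B ++ v j ∷ leg j) [ b ])
                    (cong (λ t → reverse (leg i) ++ v i ∷ t) (++-assoc B (v j ∷ leg j) [ b ]))
    long : suc (length B) < length inner
    long = begin-strict
      suc (length B)                           <⟨ s≤s (subst (suc (length B) ≤_) (sym (+-suc (length B) (length (leg j))))
                                                     (m≤m+n (suc (length B)) (length (leg j)))) ⟩
      suc (length B + suc (length (leg j)))    ≡⟨ cong suc (sym (length-++ B)) ⟩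
      length ((v i ∷ B) ++ (v j ∷ leg j))      ≤⟨ m≤n+m _ (length (reverse (leg i))) ⟩
      length (reverse (leg i)) + length ((v i ∷ B) ++ (v j ∷ leg j)) ≡⟨ sym (length-++ (reverse (leg i))) ⟩
      length inner                             ∎
      where open ≤-Reasoning

  route : ∀ i j → Route i j
  route i j with <-cmp (pos i) (pos j)
  ... | tri< lt _ _ = route-forward i j lt
  ... | tri≈ _ eq _ = subst (Route i) (pos-injective eq) (route-self i)
  ... | tri> _ _ gt = route-reverse (route-forward j i gt)

  open Neighbourhoods G C (proj₁ (proj₂ (proj₁ (proj₁ longest)))) using (hits; count-along-C) public
  open CyclicWeight (hits w) using (W; PairBound; SingleBound; cyclic-weight) public
  open Spread pos pos-injective using (spread)

  ℓ : Fin r → Fin r → ℕ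
  ℓ i j = length (Route.inner (route i j))

  far : ∀ i j → pos j < pos i + ℓ i j × pos i < pos j + ℓ i j
  far i j = Route.covers-j (route i j) , Route.covers-i (route i j)

  best-detour : ∀ x y → 0 < hits w x → 0 < hits w y →
    ∃[ P ] Detour C x P y × hits w x + hits w y ≤ length P + length P
  best-detour x y hx hy = Route.inner ρ , (Route.unique ρ , Route.avoids ρ , Route.joins ρ (edge-sym ei) fj) , bound
    where
    S T : Fin r → Bool
    S i = adj (w i) x
    T j = adj (w j) y
    chosen = spread ℓ far S T (proj₂ (Sums.positive-count S (allFin r) hx)) (proj₂ (Sums.positive-count T (allFin r) hy))
    i = proj₁ chosen
    j = proj₁ (proj₂ chosen)
    ρ : Route i j
    ρ = route i j
    ei : S i ≡ true
    ei = proj₁ (proj₂ (proj₂ chosen))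
    fj : T j ≡ true
    fj = proj₁ (proj₂ (proj₂ (proj₂ chosen)))
    bound : hits w x + hits w y ≤ ℓ i j + ℓ i j
    bound = proj₂ (proj₂ (proj₂ (proj₂ chosen)))

  pair-bound : PairBound C
  pair-bound A a B b Ys split ha hb =
    ≤-trans bound (+-mono-≤ across across) , ≤-trans bound (+-mono-≤ around around)
    where
    best = best-detour a b ha hb
    P = proj₁ best
    detour : Detour C a P b
    detour = proj₁ (proj₂ best)
    bound : hits w a + hits w b ≤ length P + length P
    bound = proj₂ (proj₂ best)
    across : length P ≤ length B
    across = detour-across longest split detour
    around : length P ≤ length A + length Ys
    around = detour-around longest split detour

  single-bound : SingleBound C
  single-bound A a Ys split ha = ≤-trans (s≤s (halve bound)) (detour-loop longest a∈C detour)
    where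
    best = best-detour a a ha ha
    P = proj₁ best
    detour : Detour C a P a
    detour = proj₁ (proj₂ best)
    bound : hits w a + hits w a ≤ length P + length P
    bound = proj₂ (proj₂ best)
    a∈C : a ∈ C
    a∈C = subst (a ∈_) (sym split) (∈-++⁺ʳ A (here refl))

lemma1 : {n : ℕ} (G : Graph n) (C : List (Fin n)) → IsLongestCycle G C →
    (M : List (Fin n)) → IsPath G M → AvoidsCycle G C M →
    (r : ℕ) (L : Fin r → List (Fin n)) (v w : Fin r → Fin n) →
    (∀ i → IsPathBetween G (L i) (v i) (w i)) →
    (∀ i → AvoidsCycle G C (L i)) →
    (∀ i j → i ≢ j → ∀ x → x ∈ L i → ¬ (x ∈ L j)) →
    (∀ i → v i ∈ M) →
    (∀ i x → x ∈ L i → x ∈ M → x ≡ v i) →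
    sumFin r (λ i → ∣ nbrsOn G C (w i) ∣) + ∣ unionFin r (λ i → nbrsOn G C (w i)) ∣
    ≤ cycleLength G C
-- Count the left-hand side along C, then apply the cyclic weight bound.
lemma1 G C longest M pathM avoidsM r L v w pathL avoidsL disjoint v∈M meet = begin
  sumFin r (λ i → ∣ nbrsOn G C (w i) ∣) + ∣ unionFin r (λ i → nbrsOn G C (w i)) ∣ ≡⟨ count-along-C w ⟩
  W C                                                                              ≤⟨ cyclic-weight pair-bound single-bound ⟩
  cycleLength G C                                                                  ∎
  where
  open ≤-Reasoning
  open Setting G C longest M pathM avoidsM r L v w pathL avoidsL disjoint v∈M meet
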